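{- Let $d\ge1$ and $d+1\le r\le 2d$ be integers. There exist constants $C>0$ and $n_0$ (depending only on $d$ and $r$) such that for all integers $n\ge n_0$, $$\overleftarrow{m}(\mathbb{T}_n^d,r)\ \ge\ 2\Big(1-\frac{d}{r}\Big)n^d-Cn^{d-1}.$$
   Context: The $d$-dimensional torus $\mathbb{T}_n^d$ is the graph with vertex set $[n]^d=\{1,\dots,n\}^d$, where two vertices are adjacent iff they differ in exactly one coordinate $j$ and in that coordinate $x_j-x'_j\equiv\pm1\pmod n$. A configuration assigns each vertex a state active (1) or inactive (0); its size is the number of active vertices. Reversible $r$-bootstrap percolation: in each round, simultaneously, every vertex becomes active if it has at least $r$ active neighbors and inactive otherwise. A dynamo is an initial configuration such that from some time on all vertices are active forever. $\overleftarrow{m}(G,r)$ denotes the minimum size of a dynamo under reversible $r$-bootstrap percolation on $G$. -}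

module Defs where

open import Data.Nat as ℕ using (ℕ; zero; suc; _≤_; _≤?_)
open import Data.Nat.Divisibility using (_∣?_)
open import Data.Integer as ℤ using (ℤ; +_)
open import Data.Integer.Divisibility using (_∣_)
open import Data.Fin using (Fin; toℕ; _≟_)
open import Data.Fin.Properties using (any?; all?)
open import Data.Vec.Functional using () renaming (_∷_ to _∷ᵥ_)
open import Data.List using (List; []; _∷_; length; filter; concatMap; map; allFin)
open import Data.Bool using (Bool; true; false)
open import Data.Bool.Properties using () renaming (_≟_ to _≟B_)
open import Data.Product using (Σ; ∃; _×_; _,_)
open import Data.Sum using (_⊎_)
open import Relation.Nullary using (Dec; yes; no; ¬_; ⌊_⌋)
open import Relation.Nullary.Decidable using (_⊎-dec_; _×-dec_; ¬?)
open import Relation.Binary.PropositionalEquality using (_≡_; _≢_)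

-- Vertices of the torus T_n^d: [n]^d, represented as Fin d → Fin n
-- (coordinates 0..n-1 instead of 1..n).
Vertex : ℕ → ℕ → Set
Vertex d n = Fin d → Fin n

PM1 : ∀ {n} → Fin n → Fin n → Set
PM1 {n} a b = ((+ n) ∣ (+ toℕ a ℤ.- + toℕ b ℤ.- + 1))
            ⊎ ((+ n) ∣ (+ toℕ a ℤ.- + toℕ b ℤ.+ + 1))

PM1? : ∀ {n} (a b : Fin n) → Dec (PM1 a b)
PM1? {n} a b = (n ∣? ℤ.∣ + toℕ a ℤ.- + toℕ b ℤ.- + 1 ∣) ⊎-dec (n ∣? ℤ.∣ + toℕ a ℤ.- + toℕ b ℤ.+ + 1 ∣)

Adj : ∀ {d n} → Vertex d n → Vertex d n → Set
Adj {d} x y = ∃ λ (j : Fin d) → (∀ i → ¬ (i ≡ j) → x i ≡ y i) × PM1 (x j) (y j)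

Adj? : ∀ {d n} (x y : Vertex d n) → Dec (Adj x y)
Adj? x y = any? (λ j → all? (λ i → (¬? (i ≟ j)) →-dec' (x i Data.Fin.≟ y i)) ×-dec PM1? (x j) (y j))
  where
  _→-dec'_ : ∀ {A B : Set} → Dec A → Dec B → Dec (A → B)
  _ →-dec' yes b = yes (λ _ → b)
  no ¬a →-dec' no _ = yes (λ a → Data.Empty.⊥-elim (¬a a))
    where import Data.Empty
  yes a →-dec' no ¬b = no (λ f → ¬b (f a))

allVertices : ∀ d n → List (Vertex d n)
allVertices zero n = (λ ()) ∷ []
allVertices (suc d) n = concatMap (λ a → map (a ∷ᵥ_) (allVertices d n)) (allFin n)

Config : ℕ → ℕ → Set
Config d n = Vertex d n → Bool

size : ∀ {d n} → Config d n → ℕ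
size {d} {n} c = length (filter (λ x → c x ≟B true) (allVertices d n))

activeNeighbours : ∀ {d n} → Config d n → Vertex d n → ℕ
activeNeighbours {d} {n} c x =
  length (filter (λ y → Adj? x y ×-dec (c y ≟B true)) (allVertices d n))

step : ∀ {d n} → ℕ → Config d n → Config d n
step r c x = ⌊ r ≤? activeNeighbours c x ⌋

run : ∀ {d n} → ℕ → Config d n → ℕ → Config d n
run r c zero = c
run r c (suc t) = step r (run r c t)

IsDynamo : ∀ {d n} → ℕ → Config d n → Set
IsDynamo r c = ∃ λ T → ∀ t → T ≤ t → ∀ x → run r c t x ≡ true

module Submission where

-- Energy argument. Along a trajectory A₀, A₁, … of reversible r-bootstrap percolation let
-- W(A, B) count the adjacent pairs (u, v) with u ∈ A and v ∈ B; W is symmetric. Comparing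
-- each vertex's state with the threshold rule shows that E(t) = r|Aₜ| + r|Aₜ₊₁| − W(Aₜ₊₁, Aₜ)
-- never increases. Every vertex of A₁ has at least r neighbours in A₀, so E(0) ≤ r|A₀|; once
-- all vertices are active, E ≥ 2r·nᵈ − 2d·nᵈ since degrees are at most 2d. Hence
-- r|A₀| ≥ 2(r − d)nᵈ, with no lower-order error term at all.

open import Defs
open import Data.Nat using (ℕ; _+_; _*_; _∸_; _^_; _≤_; _<_)
open import Data.Product using (∃; _×_)

open import Level using (0ℓ)
open import Data.Nat using (zero; suc; z≤n; s≤s; _≤?_)
open import Data.Nat.Properties hiding (_≟_)
import Data.Nat.Divisibility as ℕ
open import Data.Nat.Solver using (module +-*-Solver)
open import Data.Integer as ℤ using (ℤ)
import Data.Integer.Properties as ℤ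
open import Data.Integer.Divisibility using (_∣_)
import Data.Integer.Divisibility.Signed as Signed
import Data.Integer.Solver as ℤ-Solver
import Algebra.Properties.CommutativeSemigroup as CommSemigroupProperties
open import Data.Bool using (Bool; true; false; _∧_)
open import Data.Bool.Properties using () renaming (_≟_ to _≟ᵇ_)
open import Data.Fin using (Fin; zero; suc; toℕ; _≟_)
open import Data.Fin.Properties using (toℕ-injective; toℕ<n; all?)
import Data.Fin.Properties as Fin
open import Data.Vec.Functional using () renaming (_∷_ to _∷ᵥ_)
open import Data.List using (List; []; _∷_; _++_; length; filter; map; concatMap; tabulate; allFin)
open import Data.List.Properties using (length-tabulate)
open import Data.Product using (_,_)
open import Data.Sum using (_⊎_; inj₁; inj₂)
open import Function using (_∘_; id; mk⇔)
open import Function.Definitions using (Injective)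
open import Relation.Unary using (Pred; Decidable)
open import Relation.Nullary using (Dec; yes; no; does; ¬_; contradiction; ⌊_⌋)
open import Relation.Nullary.Decidable using (does-⇔; dec-false; _×-dec_)
open import Relation.Binary.PropositionalEquality

module +-Props = CommSemigroupProperties +-commutativeSemigroup
module *-Props = CommSemigroupProperties *-commutativeSemigroup

private
  variable
    A B : Set

-- Residues modulo n

-- ℤ's prefix +_ is opened only locally: globally it makes sections such as (k +_) ambiguous.
module _ where
  open import Data.Integer using (+_)

  n∣m<n⇒m≡0 : ∀ {m n} → n ℕ.∣ m → m < n → m ≡ 0
  n∣m<n⇒m≡0 {zero}  _   _   = refl
  n∣m<n⇒m≡0 {suc m} n∣m m<n = contradiction n∣m (ℕ.>⇒∤ m<n)

  ≡-mod⇒≡ : ∀ {n} (b c : Fin n) → + n ∣ + toℕ c ℤ.- + toℕ b → b ≡ c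
  ≡-mod⇒≡ b c n∣c-b =
    sym (toℕ-injective (ℤ.+-injective (ℤ.i-j≡0⇒i≡j _ _ (ℤ.∣i∣≡0⇒i≡0 (n∣m<n⇒m≡0 n∣c-b ∣c-b∣<n)))))
    where
    ∣c-b∣<n : ℤ.∣ + toℕ c ℤ.- + toℕ b ∣ < _
    ∣c-b∣<n = ≤-<-trans
      (≤-trans (≤-reflexive (cong ℤ.∣_∣ (ℤ.m-n≡m⊖n (toℕ c) (toℕ b)))) (ℤ.∣m⊝n∣≤m⊔n (toℕ c) (toℕ b)))
      (⊔-lub (toℕ<n c) (toℕ<n b))

  ∣-difference : ∀ k x y → k ∣ x → k ∣ y → k ∣ x ℤ.- y
  ∣-difference k x y k∣x k∣y =
    Signed.∣⇒∣ᵤ {k} {x ℤ.- y} (Signed.∣m∣n⇒∣m-n (Signed.∣ᵤ⇒∣ {k} {x} k∣x) (Signed.∣ᵤ⇒∣ {k} {y} k∣y))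

  ∣-negate : ∀ k x → k ∣ x → k ∣ ℤ.- x
  ∣-negate k x = subst (ℕ._∣_ ℤ.∣ k ∣) (sym (ℤ.∣-i∣≡∣i∣ x))

  [x-y+e]-[x-z+e]≡z-y : ∀ x y z e → (x ℤ.- y ℤ.+ e) ℤ.- (x ℤ.- z ℤ.+ e) ≡ z ℤ.- y
  [x-y+e]-[x-z+e]≡z-y = solve 4 (λ x y z e → (x :- y :+ e) :- (x :- z :+ e) := z :- y) refl
    where open ℤ-Solver.+-*-Solver

  shifted-difference-unique : ∀ {n} (e : ℤ) (a b c : Fin n) →
    + n ∣ + toℕ a ℤ.- + toℕ b ℤ.+ e → + n ∣ + toℕ a ℤ.- + toℕ c ℤ.+ e → b ≡ c
  shifted-difference-unique {n} e a b c n∣a-b+e n∣a-c+e =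
    ≡-mod⇒≡ b c (subst (+ n ∣_) ([x-y+e]-[x-z+e]≡z-y x (+ toℕ b) (+ toℕ c) e)
      (∣-difference (+ n) (x ℤ.- + toℕ b ℤ.+ e) (x ℤ.- + toℕ c ℤ.+ e) n∣a-b+e n∣a-c+e))
    where
    x : ℤ
    x = + toℕ a

  neg-[x-y+e] : ∀ x y e → ℤ.- (x ℤ.- y ℤ.+ e) ≡ y ℤ.- x ℤ.- e
  neg-[x-y+e] = solve 3 (λ x y e → :- (x :- y :+ e) := y :- x :- e) refl
    where open ℤ-Solver.+-*-Solver

  PM1-sym : ∀ {n} (a b : Fin n) → PM1 a b → PM1 b a
  PM1-sym {n} a b (inj₁ n∣a-b-1) =
    inj₂ (subst (+ n ∣_) (neg-[x-y+e] (+ toℕ a) (+ toℕ b) (ℤ.- + 1)) (∣-negate (+ n) (+ toℕ a ℤ.- + toℕ b ℤ.- + 1) n∣a-b-1))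
  PM1-sym {n} a b (inj₂ n∣a-b+1) =
    inj₁ (subst (+ n ∣_) (neg-[x-y+e] (+ toℕ a) (+ toℕ b) (+ 1)) (∣-negate (+ n) (+ toℕ a ℤ.- + toℕ b ℤ.+ + 1) n∣a-b+1))

-- Finite sums and indicators

𝟙 : Bool → ℕ
𝟙 true  = 1
𝟙 false = 0

𝟙≤1 : ∀ b → 𝟙 b ≤ 1
𝟙≤1 true  = ≤-refl
𝟙≤1 false = z≤n

𝟙-∧ : ∀ p q → 𝟙 (p ∧ q) ≡ 𝟙 p * 𝟙 q
𝟙-∧ true  q = sym (+-identityʳ (𝟙 q))
𝟙-∧ false q = refl

𝟙*m≤m : ∀ b m → 𝟙 b * m ≤ m
𝟙*m≤m true  m = ≤-reflexive (+-identityʳ m)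
𝟙*m≤m false m = z≤n

m*𝟙≤m : ∀ m b → m * 𝟙 b ≤ m
m*𝟙≤m m b = ≤-trans (≤-reflexive (*-comm m (𝟙 b))) (𝟙*m≤m b m)

𝟙-does-≟true : ∀ b → 𝟙 (does (b ≟ᵇ true)) ≡ 𝟙 b
𝟙-does-≟true true  = refl
𝟙-does-≟true false = refl

𝟙-does-mono : ∀ {P Q : Set} (P? : Dec P) (Q? : Dec Q) → (P → Q) → 𝟙 (does P?) ≤ 𝟙 (does Q?)
𝟙-does-mono P?      (yes _) _   = 𝟙≤1 (does P?)
𝟙-does-mono (yes p) (no ¬q) P→Q = contradiction (P→Q p) ¬q
𝟙-does-mono (no _)  (no _)  _   = z≤n

𝟙-does-⊎ : ∀ {P Q R : Set} (P? : Dec P) (Q? : Dec Q) (R? : Dec R) → (P → Q ⊎ R) →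
  𝟙 (does P?) ≤ 𝟙 (does Q?) + 𝟙 (does R?)
𝟙-does-⊎ (no _)  Q? R? _ = z≤n
𝟙-does-⊎ (yes p) Q? R? P→Q⊎R with P→Q⊎R p
... | inj₁ q = ≤-trans (𝟙-does-mono (yes p) Q? (λ _ → q)) (m≤m+n _ _)
... | inj₂ r = ≤-trans (𝟙-does-mono (yes p) R? (λ _ → r)) (m≤n+m _ _)

∑ : List A → (A → ℕ) → ℕ
∑ []       f = 0
∑ (x ∷ xs) f = f x + ∑ xs f

∑-cong : ∀ (l : List A) {f g : A → ℕ} → (∀ x → f x ≡ g x) → ∑ l f ≡ ∑ l g
∑-cong []      f≗g = refl
∑-cong (x ∷ l) f≗g = cong₂ _+_ (f≗g x) (∑-cong l f≗g)

∑-mono-≤ : ∀ (l : List A) {f g : A → ℕ} → (∀ x → f x ≤ g x) → ∑ l f ≤ ∑ l g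
∑-mono-≤ []      f≤g = z≤n
∑-mono-≤ (x ∷ l) f≤g = +-mono-≤ (f≤g x) (∑-mono-≤ l f≤g)

∑-distrib-+ : ∀ (l : List A) (f g : A → ℕ) → ∑ l (λ x → f x + g x) ≡ ∑ l f + ∑ l g
∑-distrib-+ []      f g = refl
∑-distrib-+ (x ∷ l) f g =
  trans (cong (f x + g x +_) (∑-distrib-+ l f g)) (+-Props.interchange (f x) (g x) (∑ l f) (∑ l g))

*-distribˡ-∑ : ∀ k (l : List A) (f : A → ℕ) → k * ∑ l f ≡ ∑ l (λ x → k * f x)
*-distribˡ-∑ k []      f = *-zeroʳ k
*-distribˡ-∑ k (x ∷ l) f = trans (*-distribˡ-+ k (f x) (∑ l f)) (cong (k * f x +_) (*-distribˡ-∑ k l f))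

*-distribʳ-∑ : ∀ k (l : List A) (f : A → ℕ) → ∑ l f * k ≡ ∑ l (λ x → f x * k)
*-distribʳ-∑ k []      f = refl
*-distribʳ-∑ k (x ∷ l) f = trans (*-distribʳ-+ k (f x) (∑ l f)) (cong (f x * k +_) (*-distribʳ-∑ k l f))

∑-const : ∀ (l : List A) k → ∑ l (λ _ → k) ≡ length l * k
∑-const []      k = refl
∑-const (x ∷ l) k = cong (k +_) (∑-const l k)

length≡∑1 : ∀ (l : List A) → length l ≡ ∑ l (λ _ → 1)
length≡∑1 []      = refl
length≡∑1 (x ∷ l) = cong suc (length≡∑1 l)

∑-++ : ∀ (l m : List A) (f : A → ℕ) → ∑ (l ++ m) f ≡ ∑ l f + ∑ m f
∑-++ []      m f = refl
∑-++ (x ∷ l) m f = trans (cong (f x +_) (∑-++ l m f)) (sym (+-assoc (f x) (∑ l f) (∑ m f)))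

∑-map : ∀ (g : B → A) (l : List B) (f : A → ℕ) → ∑ (map g l) f ≡ ∑ l (f ∘ g)
∑-map g []      f = refl
∑-map g (x ∷ l) f = cong (f (g x) +_) (∑-map g l f)

∑-concatMap : ∀ (g : B → List A) (l : List B) (f : A → ℕ) →
  ∑ (concatMap g l) f ≡ ∑ l (λ y → ∑ (g y) f)
∑-concatMap g []      f = refl
∑-concatMap g (y ∷ l) f = trans (∑-++ (g y) (concatMap g l) f) (cong (∑ (g y) f +_) (∑-concatMap g l f))

∑-comm : ∀ (l : List A) (m : List B) (f : A → B → ℕ) →
  ∑ l (λ x → ∑ m (f x)) ≡ ∑ m (λ y → ∑ l (λ x → f x y))
∑-comm []      m f = sym (trans (∑-const m 0) (*-zeroʳ (length m)))
∑-comm (x ∷ l) m f =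
  trans (cong (∑ m (f x) +_) (∑-comm l m f)) (sym (∑-distrib-+ m (f x) (λ y → ∑ l (λ x → f x y))))

∑-∧-≤ : ∀ (l : List A) p (q : A → Bool) {k} → ∑ l (𝟙 ∘ q) ≤ k → ∑ l (λ x → 𝟙 (p ∧ q x)) ≤ 𝟙 p * k
∑-∧-≤ l p q {k} ∑q≤k = begin
  ∑ l (λ x → 𝟙 (p ∧ q x))   ≡⟨ ∑-cong l (λ x → 𝟙-∧ p (q x)) ⟩
  ∑ l (λ x → 𝟙 p * 𝟙 (q x)) ≡⟨ *-distribˡ-∑ (𝟙 p) l (𝟙 ∘ q) ⟨
  𝟙 p * ∑ l (𝟙 ∘ q)         ≤⟨ *-monoʳ-≤ (𝟙 p) ∑q≤k ⟩
  𝟙 p * k                   ∎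
  where open ≤-Reasoning

length-filter≡∑ : ∀ {P : Pred A 0ℓ} (P? : Decidable P) (l : List A) →
  length (filter P? l) ≡ ∑ l (λ x → 𝟙 (does (P? x)))
length-filter≡∑ P? []      = refl
length-filter≡∑ P? (x ∷ l) with does (P? x)
... | true  = cong suc (length-filter≡∑ P? l)
... | false = length-filter≡∑ P? l

module _ {P : Pred A 0ℓ} (P? : Decidable P) where

  ∑-tabulate-none : ∀ {n} (h : Fin n → A) → (∀ i → ¬ P (h i)) → ∑ (tabulate h) (λ a → 𝟙 (does (P? a))) ≡ 0
  ∑-tabulate-none {zero}  h ¬P = refl
  ∑-tabulate-none {suc n} h ¬P with P? (h zero)
  ... | yes p = contradiction p (¬P zero)
  ... | no  _ = ∑-tabulate-none (h ∘ suc) (¬P ∘ suc)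

  ∑-tabulate-atMostOne : ∀ {n} (h : Fin n → A) → Injective _≡_ _≡_ h → (∀ {a b} → P a → P b → a ≡ b) →
    ∑ (tabulate h) (λ a → 𝟙 (does (P? a))) ≤ 1
  ∑-tabulate-atMostOne {zero}  h inj unique = z≤n
  ∑-tabulate-atMostOne {suc n} h inj unique with P? (h zero)
  ... | yes p = ≤-reflexive (cong suc (∑-tabulate-none (h ∘ suc) λ i q → 0≢1+n (cong toℕ (inj (unique p q)))))
  ... | no  _ = ∑-tabulate-atMostOne (h ∘ suc) (Fin.suc-injective ∘ inj) unique

-- The energy argument on a finite graph

-- With s = [r ≤ k] this is (s − a)(k − r) ≥ 0.
threshold-exchange : ∀ r k a → r * 𝟙 ⌊ r ≤? k ⌋ + 𝟙 a * k ≤ r * 𝟙 a + 𝟙 ⌊ r ≤? k ⌋ * k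
threshold-exchange r k true with r ≤? k
... | yes _   = ≤-refl
... | no  r≰k = begin
  r * 0 + (k + 0) ≡⟨ cong₂ _+_ (*-zeroʳ r) (+-identityʳ k) ⟩
  k               ≤⟨ <⇒≤ (≰⇒> r≰k) ⟩
  r               ≡⟨ trans (+-identityʳ (r * 1)) (*-identityʳ r) ⟨
  r * 1 + 0       ∎
  where open ≤-Reasoning
threshold-exchange r k false with r ≤? k
... | no  _   = ≤-refl
... | yes r≤k = begin
  r * 1 + 0       ≡⟨ trans (+-identityʳ (r * 1)) (*-identityʳ r) ⟩
  r               ≤⟨ r≤k ⟩
  k               ≡⟨ cong₂ _+_ (*-zeroʳ r) (+-identityʳ k) ⟨
  r * 0 + (k + 0) ∎
  where open ≤-Reasoning

threshold-weight : ∀ r k → r * 𝟙 ⌊ r ≤? k ⌋ ≤ 𝟙 ⌊ r ≤? k ⌋ * k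
threshold-weight r k with r ≤? k
... | yes r≤k = ≤-trans (≤-reflexive (*-identityʳ r)) (≤-trans r≤k (≤-reflexive (sym (+-identityʳ k))))
... | no  _   = ≤-reflexive (*-zeroʳ r)

telescope-≤ : ∀ (f g : ℕ → ℕ) → (∀ t → f (suc t) + g t ≤ f t + g (suc t)) →
  ∀ t → f t + g 0 ≤ f 0 + g t
telescope-≤ f g step zero    = ≤-refl
telescope-≤ f g step (suc t) = +-cancelʳ-≤ (f t + g t) _ _ (begin
  f (suc t) + g 0 + (f t + g t) ≡⟨ solve 4 (λ a b c d → (a :+ b) :+ (c :+ d) := (a :+ d) :+ (c :+ b)) refl
                                       (f (suc t)) (g 0) (f t) (g t) ⟩
  f (suc t) + g t + (f t + g 0) ≤⟨ +-mono-≤ (step t) (telescope-≤ f g step t) ⟩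
  f t + g (suc t) + (f 0 + g t) ≡⟨ solve 4 (λ a b c d → (a :+ b) :+ (c :+ d) := (c :+ b) :+ (a :+ d)) refl
                                       (f t) (g (suc t)) (f 0) (g t) ⟩
  f 0 + g (suc t) + (f t + g t) ∎)
  where
  open ≤-Reasoning
  open +-*-Solver

-- The neighbour count is a parameter, specified by activeNbrs≡∑, so that the torus's own
-- activeNeighbours makes run a trajectory definitionally.
module ReversibleBootstrap {V : Set} (vertices : List V) (adj : V → V → Bool)
  (adj-sym : ∀ u v → adj u v ≡ adj v u)
  (Δ : ℕ) (degree-≤ : ∀ u → ∑ vertices (λ v → 𝟙 (adj u v)) ≤ Δ)
  (activeNbrs : (V → Bool) → V → ℕ)
  (activeNbrs≡∑ : ∀ c u → activeNbrs c u ≡ ∑ vertices (λ v → 𝟙 (adj u v) * 𝟙 (c v)))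
  (r : ℕ)
  where

  active : (V → Bool) → ℕ
  active c = ∑ vertices (𝟙 ∘ c)

  threshold : (V → Bool) → V → Bool
  threshold c u = ⌊ r ≤? activeNbrs c u ⌋

  weight : (V → Bool) → (V → Bool) → ℕ
  weight a b = ∑ vertices (λ u → 𝟙 (a u) * activeNbrs b u)

  weight≡∑∑ : ∀ a b → weight a b ≡ ∑ vertices (λ u → ∑ vertices (λ v → 𝟙 (a u) * (𝟙 (adj u v) * 𝟙 (b v))))
  weight≡∑∑ a b = ∑-cong vertices λ u →
    trans (cong (𝟙 (a u) *_) (activeNbrs≡∑ b u)) (*-distribˡ-∑ (𝟙 (a u)) vertices _)

  weight-sym : ∀ a b → weight a b ≡ weight b a
  weight-sym a b = begin
    weight a b
      ≡⟨ weight≡∑∑ a b ⟩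
    ∑ vertices (λ u → ∑ vertices (λ v → 𝟙 (a u) * (𝟙 (adj u v) * 𝟙 (b v))))
      ≡⟨ ∑-comm vertices vertices _ ⟩
    ∑ vertices (λ v → ∑ vertices (λ u → 𝟙 (a u) * (𝟙 (adj u v) * 𝟙 (b v))))
      ≡⟨ ∑-cong vertices (λ v → ∑-cong vertices λ u →
           trans (cong (λ e → 𝟙 (a u) * (𝟙 e * 𝟙 (b v))) (adj-sym u v))
                 (*-Props.x∙yz≈z∙yx (𝟙 (a u)) (𝟙 (adj v u)) (𝟙 (b v)))) ⟩
    ∑ vertices (λ v → ∑ vertices (λ u → 𝟙 (b v) * (𝟙 (adj v u) * 𝟙 (a u))))
      ≡⟨ weight≡∑∑ b a ⟨
    weight b a ∎
    where open ≡-Reasoning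

  activeNbrs-≤ : ∀ c u → activeNbrs c u ≤ Δ
  activeNbrs-≤ c u = begin
    activeNbrs c u                                ≡⟨ activeNbrs≡∑ c u ⟩
    ∑ vertices (λ v → 𝟙 (adj u v) * 𝟙 (c v))    ≤⟨ ∑-mono-≤ vertices (λ v → m*𝟙≤m (𝟙 (adj u v)) (c v)) ⟩
    ∑ vertices (λ v → 𝟙 (adj u v))              ≤⟨ degree-≤ u ⟩
    Δ                                             ∎
    where open ≤-Reasoning

  weight-≤ : ∀ a b → weight a b ≤ length vertices * Δ
  weight-≤ a b = begin
    weight a b           ≤⟨ ∑-mono-≤ vertices (λ u → ≤-trans (𝟙*m≤m (a u) _) (activeNbrs-≤ b u)) ⟩
    ∑ vertices (λ _ → Δ) ≡⟨ ∑-const vertices Δ ⟩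
    length vertices * Δ  ∎
    where open ≤-Reasoning

  active-threshold-≤ : ∀ c → r * active (threshold c) ≤ weight (threshold c) c
  active-threshold-≤ c = begin
    r * active (threshold c)                      ≡⟨ *-distribˡ-∑ r vertices _ ⟩
    ∑ vertices (λ u → r * 𝟙 (threshold c u))     ≤⟨ ∑-mono-≤ vertices (λ u → threshold-weight r (activeNbrs c u)) ⟩
    weight (threshold c) c                        ∎
    where open ≤-Reasoning

  weight-step : ∀ a b → r * active (threshold b) + weight a b ≤ r * active a + weight (threshold b) b
  weight-step a b = begin
    r * active (threshold b) + weight a b
      ≡⟨ cong (_+ weight a b) (*-distribˡ-∑ r vertices _) ⟩
    ∑ vertices (λ u → r * 𝟙 (threshold b u)) + weight a b
      ≡⟨ ∑-distrib-+ vertices _ _ ⟨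
    ∑ vertices (λ u → r * 𝟙 (threshold b u) + 𝟙 (a u) * activeNbrs b u)
      ≤⟨ ∑-mono-≤ vertices (λ u → threshold-exchange r (activeNbrs b u) (a u)) ⟩
    ∑ vertices (λ u → r * 𝟙 (a u) + 𝟙 (threshold b u) * activeNbrs b u)
      ≡⟨ ∑-distrib-+ vertices _ _ ⟩
    ∑ vertices (λ u → r * 𝟙 (a u)) + weight (threshold b) b
      ≡⟨ cong (_+ weight (threshold b) b) (*-distribˡ-∑ r vertices _) ⟨
    r * active a + weight (threshold b) b ∎
    where open ≤-Reasoning

  active-full : ∀ c → (∀ u → c u ≡ true) → active c ≡ length vertices
  active-full c full = trans (∑-cong vertices (λ u → cong 𝟙 (full u))) (sym (length≡∑1 vertices))

  module Trajectory (A : ℕ → V → Bool) (A-step : ∀ t → A (suc t) ≡ threshold (A t)) where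

    -- E(t) = potential t − interaction t, kept as two terms to avoid truncated subtraction.
    potential : ℕ → ℕ
    potential t = r * active (A t) + r * active (A (suc t))

    interaction : ℕ → ℕ
    interaction t = weight (A (suc t)) (A t)

    interaction-step : ∀ t → r * active (A (suc (suc t))) + weight (A (suc t)) (A t)
                           ≤ r * active (A t) + weight (A (suc (suc t))) (A (suc t))
    interaction-step t rewrite A-step (suc t) | weight-sym (A (suc t)) (A t) = weight-step (A t) (A (suc t))

    potential-step : ∀ t → potential (suc t) + interaction t ≤ potential t + interaction (suc t)
    potential-step t = begin
      (y + z) + interaction t       ≡⟨ +-assoc y z (interaction t) ⟩
      y + (z + interaction t)       ≤⟨ +-monoʳ-≤ y (interaction-step t) ⟩
      y + (x + interaction (suc t)) ≡⟨ +-Props.x∙yz≈yx∙z y x (interaction (suc t)) ⟩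
      (x + y) + interaction (suc t) ∎
      where
      open ≤-Reasoning
      x y z : ℕ
      x = r * active (A t)
      y = r * active (A (suc t))
      z = r * active (A (suc (suc t)))

    first-interaction : r * active (A 1) ≤ interaction 0
    first-interaction rewrite A-step 0 = active-threshold-≤ (A 0)

    eventually-full-bound : ∀ T → (∀ u → A T u ≡ true) → (∀ u → A (suc T) u ≡ true) →
      r * length vertices + r * length vertices ≤ r * active (A 0) + length vertices * Δ
    eventually-full-bound T full full′ = +-cancelʳ-≤ (r * active (A 1)) _ _ (begin
      r * length vertices + r * length vertices + r * active (A 1)
        ≡⟨ cong₂ (λ a b → r * a + r * b + r * active (A 1))
                 (active-full (A T) full) (active-full (A (suc T)) full′) ⟨
      potential T + r * active (A 1)
        ≤⟨ +-monoʳ-≤ (potential T) first-interaction ⟩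
      potential T + interaction 0
        ≤⟨ telescope-≤ potential interaction potential-step T ⟩
      potential 0 + interaction T
        ≤⟨ +-monoʳ-≤ (potential 0) (weight-≤ (A (suc T)) (A T)) ⟩
      r * active (A 0) + r * active (A 1) + length vertices * Δ
        ≡⟨ +-Props.xy∙z≈xz∙y (r * active (A 0)) (r * active (A 1)) (length vertices * Δ) ⟩
      r * active (A 0) + length vertices * Δ + r * active (A 1) ∎)
      where open ≤-Reasoning

-- The torus

module _ {n : ℕ} where

  infix 4 _≗?_
  _≗?_ : ∀ {d} (x y : Vertex d n) → Dec (∀ i → x i ≡ y i)
  x ≗? y = all? (λ i → x i ≟ y i)

  ∑-allVertices-suc : ∀ d (f : Vertex (suc d) n → ℕ) →
    ∑ (allVertices (suc d) n) f ≡ ∑ (allFin n) (λ b → ∑ (allVertices d n) (λ y → f (b ∷ᵥ y)))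
  ∑-allVertices-suc d f = trans (∑-concatMap _ (allFin n) f)
                                (∑-cong (allFin n) (λ b → ∑-map (b ∷ᵥ_) (allVertices d n) f))

  length-allVertices : ∀ d → length (allVertices d n) ≡ n ^ d
  length-allVertices zero    = refl
  length-allVertices (suc d) = begin
    length (allVertices (suc d) n)                          ≡⟨ length≡∑1 (allVertices (suc d) n) ⟩
    ∑ (allVertices (suc d) n) (λ _ → 1)                     ≡⟨ ∑-allVertices-suc d _ ⟩
    ∑ (allFin n) (λ _ → ∑ (allVertices d n) (λ _ → 1))      ≡⟨ ∑-cong (allFin n) (λ _ → sym (length≡∑1 (allVertices d n))) ⟩
    ∑ (allFin n) (λ _ → length (allVertices d n))          ≡⟨ ∑-cong (allFin n) (λ _ → length-allVertices d) ⟩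
    ∑ (allFin n) (λ _ → n ^ d)                              ≡⟨ ∑-const (allFin n) (n ^ d) ⟩
    length (allFin n) * n ^ d                               ≡⟨ cong (_* n ^ d) (length-tabulate {n = n} id) ⟩
    n * n ^ d                                               ∎
    where open ≡-Reasoning

  count-≡-≤1 : (a : Fin n) → ∑ (allFin n) (λ b → 𝟙 (does (a ≟ b))) ≤ 1
  count-≡-≤1 a = ∑-tabulate-atMostOne (a ≟_) id id (λ a≡b a≡c → trans (sym a≡b) a≡c)

  count-≗-≤1 : ∀ d (x : Vertex d n) → ∑ (allVertices d n) (λ y → 𝟙 (does (x ≗? y))) ≤ 1
  count-≗-≤1 zero    x = +-monoˡ-≤ 0 (𝟙≤1 _)
  count-≗-≤1 (suc d) x = begin
    ∑ (allVertices (suc d) n) (λ y → 𝟙 (does (x ≗? y)))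
      ≡⟨ ∑-allVertices-suc d _ ⟩
    ∑ (allFin n) (λ b → ∑ (allVertices d n) (λ y → 𝟙 (does (x ≗? b ∷ᵥ y))))
      ≤⟨ ∑-mono-≤ (allFin n) (λ b → ∑-mono-≤ (allVertices d n) λ y →
           𝟙-does-mono (x ≗? b ∷ᵥ y) ((x zero ≟ b) ×-dec (x ∘ suc ≗? y)) (λ x≗y → x≗y zero , x≗y ∘ suc)) ⟩
    ∑ (allFin n) (λ b → ∑ (allVertices d n) (λ y → 𝟙 (does (x zero ≟ b) ∧ does (x ∘ suc ≗? y))))
      ≤⟨ ∑-mono-≤ (allFin n) (λ b → ∑-∧-≤ (allVertices d n) _ _ (count-≗-≤1 d (x ∘ suc))) ⟩
    ∑ (allFin n) (λ b → 𝟙 (does (x zero ≟ b)) * 1)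
      ≡⟨ *-distribʳ-∑ 1 (allFin n) _ ⟨
    ∑ (allFin n) (λ b → 𝟙 (does (x zero ≟ b))) * 1
      ≤⟨ *-monoˡ-≤ 1 (count-≡-≤1 (x zero)) ⟩
    1 ∎
    where open ≤-Reasoning

  count-PM1-≤2 : (a : Fin n) → ∑ (allFin n) (λ b → 𝟙 (does (PM1? a b))) ≤ 2
  count-PM1-≤2 a = begin
    ∑ (allFin n) (λ b → 𝟙 (does (PM1? a b)))
      ≤⟨ ∑-mono-≤ (allFin n) (λ b → 𝟙-does-⊎ (PM1? a b) (below? b) (above? b) id) ⟩
    ∑ (allFin n) (λ b → 𝟙 (does (below? b)) + 𝟙 (does (above? b)))
      ≡⟨ ∑-distrib-+ (allFin n) _ _ ⟩
    ∑ (allFin n) (λ b → 𝟙 (does (below? b))) + ∑ (allFin n) (λ b → 𝟙 (does (above? b)))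
      ≤⟨ +-mono-≤ (∑-tabulate-atMostOne below? id id (shifted-difference-unique (ℤ.- + 1) a _ _))
                  (∑-tabulate-atMostOne above? id id (shifted-difference-unique (+ 1) a _ _)) ⟩
    2 ∎
    where
    open ≤-Reasoning
    open import Data.Integer using (+_)
    below? : ∀ b → Dec (+ n ∣ + toℕ a ℤ.- + toℕ b ℤ.- + 1)
    below? b = n ℕ.∣? ℤ.∣ + toℕ a ℤ.- + toℕ b ℤ.- + 1 ∣
    above? : ∀ b → Dec (+ n ∣ + toℕ a ℤ.- + toℕ b ℤ.+ + 1)
    above? b = n ℕ.∣? ℤ.∣ + toℕ a ℤ.- + toℕ b ℤ.+ + 1 ∣

  Adj-∷-split : ∀ {d} (x : Vertex (suc d) n) b (y : Vertex d n) → Adj x (b ∷ᵥ y) →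
    (PM1 (x zero) b × (∀ i → x (suc i) ≡ y i)) ⊎ (x zero ≡ b × Adj (x ∘ suc) y)
  Adj-∷-split x b y (zero  , x≡y , x~y) = inj₁ (x~y , λ i → x≡y (suc i) (λ ()))
  Adj-∷-split x b y (suc j , x≡y , x~y) =
    inj₂ (x≡y zero (λ ()) , j , (λ i i≢j → x≡y (suc i) (i≢j ∘ Fin.suc-injective)) , x~y)

  Adj-degree-≤ : ∀ d (x : Vertex d n) → ∑ (allVertices d n) (λ y → 𝟙 (does (Adj? x y))) ≤ 2 * d
  Adj-degree-≤ zero    x = ≤-reflexive (cong (λ b → 𝟙 b + 0) (dec-false (Adj? x (λ ())) λ { (() , _) }))
  Adj-degree-≤ (suc d) x = begin
    ∑ (allVertices (suc d) n) (λ y → 𝟙 (does (Adj? x y)))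
      ≡⟨ ∑-allVertices-suc d _ ⟩
    ∑ (allFin n) (λ b → ∑ V (λ y → 𝟙 (does (Adj? x (b ∷ᵥ y)))))
      ≤⟨ ∑-mono-≤ (allFin n) (λ b → ∑-mono-≤ V λ y →
           𝟙-does-⊎ (Adj? x (b ∷ᵥ y)) (PM1? x₀ b ×-dec x′ ≗? y) ((x₀ ≟ b) ×-dec Adj? x′ y) (Adj-∷-split x b y)) ⟩
    ∑ (allFin n) (λ b → ∑ V (λ y → 𝟙 (does (PM1? x₀ b) ∧ does (x′ ≗? y)) + 𝟙 (does (x₀ ≟ b) ∧ does (Adj? x′ y))))
      ≤⟨ ∑-mono-≤ (allFin n) (λ b → ≤-trans (≤-reflexive (∑-distrib-+ V _ _))
           (+-mono-≤ (∑-∧-≤ V (does (PM1? x₀ b)) (does ∘ (x′ ≗?_)) (count-≗-≤1 d x′))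
                     (∑-∧-≤ V (does (x₀ ≟ b)) (does ∘ Adj? x′) (Adj-degree-≤ d x′)))) ⟩
    ∑ (allFin n) (λ b → 𝟙 (does (PM1? x₀ b)) * 1 + 𝟙 (does (x₀ ≟ b)) * (2 * d))
      ≡⟨ ∑-distrib-+ (allFin n) _ _ ⟩
    ∑ (allFin n) (λ b → 𝟙 (does (PM1? x₀ b)) * 1) + ∑ (allFin n) (λ b → 𝟙 (does (x₀ ≟ b)) * (2 * d))
      ≡⟨ cong₂ _+_ (*-distribʳ-∑ 1 (allFin n) _) (*-distribʳ-∑ (2 * d) (allFin n) _) ⟨
    ∑ (allFin n) (λ b → 𝟙 (does (PM1? x₀ b))) * 1 + ∑ (allFin n) (λ b → 𝟙 (does (x₀ ≟ b))) * (2 * d)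
      ≤⟨ +-mono-≤ (*-monoˡ-≤ 1 (count-PM1-≤2 x₀)) (*-monoˡ-≤ (2 * d) (count-≡-≤1 x₀)) ⟩
    2 * 1 + 1 * (2 * d)
      ≡⟨ trans (cong (2 +_) (*-identityˡ (2 * d))) (sym (*-suc 2 d)) ⟩
    2 * suc d ∎
    where
    open ≤-Reasoning
    V : List (Vertex d n)
    V = allVertices d n
    x₀ : Fin n
    x₀ = x zero
    x′ : Vertex d n
    x′ = x ∘ suc

  Adj-sym : ∀ {d} {x y : Vertex d n} → Adj x y → Adj y x
  Adj-sym {x = x} {y} (j , x≡y , x~y) = j , (λ i i≢j → sym (x≡y i i≢j)) , PM1-sym (x j) (y j) x~y

  does-Adj?-sym : ∀ {d} (x y : Vertex d n) → does (Adj? x y) ≡ does (Adj? y x)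
  does-Adj?-sym x y = does-⇔ (mk⇔ Adj-sym Adj-sym) (Adj? x y) (Adj? y x)

size≡∑ : ∀ {d n} (c : Config d n) → size c ≡ ∑ (allVertices d n) (𝟙 ∘ c)
size≡∑ {d} {n} c =
  trans (length-filter≡∑ (λ x → c x ≟ᵇ true) (allVertices d n)) (∑-cong (allVertices d n) (𝟙-does-≟true ∘ c))

activeNeighbours≡∑ : ∀ {d n} (c : Config d n) x →
  activeNeighbours c x ≡ ∑ (allVertices d n) (λ y → 𝟙 (does (Adj? x y)) * 𝟙 (c y))
activeNeighbours≡∑ {d} {n} c x =
  trans (length-filter≡∑ (λ y → Adj? x y ×-dec (c y ≟ᵇ true)) (allVertices d n))
        (∑-cong (allVertices d n) λ y → trans (𝟙-∧ (does (Adj? x y)) _) (cong (𝟙 (does (Adj? x y)) *_) (𝟙-does-≟true (c y))))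

torus-dynamo-bound : ∀ {d n} r (c : Config d n) → d ≤ r → IsDynamo r c → 2 * (r ∸ d) * n ^ d ≤ r * size c
torus-dynamo-bound {d} {n} r c d≤r (T , dynamo) = +-cancelʳ-≤ (2 * d * n ^ d) _ _ (begin
  2 * (r ∸ d) * n ^ d + 2 * d * n ^ d
    ≡⟨ 2[r-d]+2d≡2r ⟩
  r * n ^ d + r * n ^ d
    ≡⟨ cong (λ m → r * m + r * m) (length-allVertices d) ⟨
  r * length V + r * length V
    ≤⟨ Trajectory.eventually-full-bound (run r c) (λ _ → refl) T (dynamo T ≤-refl) (dynamo (suc T) (n≤1+n T)) ⟩
  r * active c + length V * (2 * d)
    ≡⟨ cong₂ (λ s m → r * s + m * (2 * d)) (sym (size≡∑ c)) (length-allVertices d) ⟩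
  r * size c + n ^ d * (2 * d)
    ≡⟨ cong (r * size c +_) (*-comm (n ^ d) (2 * d)) ⟩
  r * size c + 2 * d * n ^ d ∎)
  where
  open ≤-Reasoning
  V : List (Vertex d n)
  V = allVertices d n
  open ReversibleBootstrap V (λ x y → does (Adj? x y)) does-Adj?-sym
         (2 * d) (Adj-degree-≤ d) activeNeighbours activeNeighbours≡∑ r
  2[r-d]+2d≡2r : 2 * (r ∸ d) * n ^ d + 2 * d * n ^ d ≡ r * n ^ d + r * n ^ d
  2[r-d]+2d≡2r = trans
    (solve 3 (λ x y z → con 2 :* x :* z :+ con 2 :* y :* z := (x :+ y) :* z :+ (x :+ y) :* z) refl (r ∸ d) d (n ^ d))
    (cong (λ m → m * n ^ d + m * n ^ d) (m∸n+n≡m d≤r))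
    where open +-*-Solver

theorem2 : ∀ (d r : ℕ) → 1 ≤ d → d + 1 ≤ r → r ≤ 2 * d →
    ∃ λ (C : ℕ) → ∃ λ (n₀ : ℕ) → 0 < C ×
    (∀ (n : ℕ) → n₀ ≤ n → ∀ (c : Config d n) → IsDynamo r c →
    2 * (r ∸ d) * n ^ d ≤ r * size c + r * C * n ^ (d ∸ 1))
-- The bound holds without an error term, so C = 1 and n₀ = 0 work.
theorem2 d r _ d+1≤r _ = 1 , 0 , s≤s z≤n , λ n _ c dynamo →
  ≤-trans (torus-dynamo-bound r c (≤-trans (m≤m+n d 1) d+1≤r) dynamo) (m≤m+n _ _)
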